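{- Let $c$ be a positive integer, $k$ a nonnegative integer, $P_k(X):=\prod_{s=0}^{k}(X-s+\sqrt{ -c})$, and let $D:=\mathbb{C}\setminus\{j-2\sqrt{ -c}: j\in\mathbb{Z},\ -k\le j\le k\}$. For $\ell\in\{0,1,\dots,k\}$ and $z\in D$ define \[R_{k,\ell}(z):=\frac{1}{\ell!}\sum_{j=0}^{\ell}(-1)^{\ell-j}\binom{\ell}{j}\frac{1}{P_k(z+j+\sqrt{ -c})}.\] Then for all $\ell\in\mathbb{N}$ with $\ell\le k$ and all $z\in D$, \[R_{k,\ell}(z)=\frac{(-1)^{k+\ell}}{z+2\sqrt{ -c}}\binom{k+\ell}{\ell}\frac{1}{\left(k-2\sqrt{ -c}-z\right)^{\underline{k}}\left(\ell+2\sqrt{ -c}+z\right)^{\underline{\ell}}}.\]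
   Context: Here $\sqrt{ -c}=i\sqrt{c}$, and for a complex number $x$ and $n\in\mathbb{N}$, $x^{\underline{n}}:=x(x-1)(x-2)\cdots(x-n+1)$ (with $x^{\underline{0}}=1$). -}

module Defs where

open import Level using (Level; _⊔_) renaming (suc to lsuc)
open import Data.Nat using (ℕ; zero; suc; _!) renaming (_+_ to _+ℕ_; _∸_ to _∸ℕ_)
open import Data.Nat.Combinatorics using (_C_)
open import Data.Integer using (ℤ; +_; -[1+_]) renaming (_≤_ to _≤ℤ_; -_ to -ℤ_)
open import Data.Product renaming (_×_ to _∧_) using ()
open import Relation.Nullary using (¬_)
open import Algebra.Bundles using (CommutativeRing)

natIn : {c ℓ : Level} (R : CommutativeRing c ℓ) → ℕ → CommutativeRing.Carrier R
natIn R zero    = CommutativeRing.0# R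
natIn R (suc n) = CommutativeRing._+_ R (CommutativeRing.1# R) (natIn R n)

-- A field of characteristic zero, with a total inverse (convention 0⁻¹ = 0).
-- ℂ is an instance; the standard library has no complex numbers.
record CharZeroField (c ℓ : Level) : Set (lsuc (c ⊔ ℓ)) where
  field
    commutativeRing : CommutativeRing c ℓ
  open CommutativeRing commutativeRing public
  field
    _⁻¹      : Carrier → Carrier
    ⁻¹-cong  : ∀ {x y} → x ≈ y → x ⁻¹ ≈ y ⁻¹
    inverseʳ : ∀ x → ¬ (x ≈ 0#) → x * (x ⁻¹) ≈ 1#
    zero⁻¹   : 0# ⁻¹ ≈ 0#
    charZero : ∀ (n : ℕ) → ¬ (natIn commutativeRing (suc n) ≈ 0#)

module FieldNotation {c ℓ : Level} (F : CharZeroField c ℓ) where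
  open CharZeroField F

  infixl 7 _/_
  _/_ : Carrier → Carrier → Carrier
  x / y = x * (y ⁻¹)

  ι : ℕ → Carrier
  ι n = natIn commutativeRing n

  ιℤ : ℤ → Carrier
  ιℤ (+ n)     = ι n
  ιℤ -[1+ n ]  = - ι (suc n)

  sgn : ℕ → Carrier
  sgn zero    = 1#
  sgn (suc n) = - sgn n

  sumBelow : ℕ → (ℕ → Carrier) → Carrier
  sumBelow zero    f = 0#
  sumBelow (suc n) f = sumBelow n f + f n

  prodBelow : ℕ → (ℕ → Carrier) → Carrier
  prodBelow zero    f = 1#
  prodBelow (suc n) f = prodBelow n f * f n

  fallingFact : Carrier → ℕ → Carrier
  fallingFact x zero    = 1#
  fallingFact x (suc n) = fallingFact x n * (x - ι n)

  -- P_k(X) = ∏_{s=0}^{k} (X - s + r),  where r plays the role of √-c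
  P : (r : Carrier) → ℕ → Carrier → Carrier
  P r k X = prodBelow (suc k) (λ t → X - ι t + r)

  R : (r : Carrier) → ℕ → ℕ → Carrier → Carrier
  R r k l z =
    (ι (l !)) ⁻¹ *
      sumBelow (suc l) (λ j → sgn (l ∸ℕ j) * ι (l C j) / P r k (z + ι j + r))

  InD : (r : Carrier) → ℕ → Carrier → Set ℓ
  InD r k z = ∀ (j : ℤ) → (-ℤ (+ k) ≤ℤ j) ∧ (j ≤ℤ + k) → ¬ (z ≈ ιℤ j - (r + r))

{-# OPTIONS --safe #-}
module Submission where

-- With w = z + 2√-c the factors of P_k(z + j + √-c) are w + j - s, so ℓ! R_{k,ℓ}(z) is the
-- ℓ-th forward difference at 0 of j ↦ 1 / (w + j)^{\underline{k+1}}. Since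
-- Δ (1 / x^{\underline n}) = -n / (x + 1)^{\underline{n+1}}, that difference is
-- (-1)^ℓ (k+1)⋯(k+ℓ) / (w + ℓ)^{\underline{k+ℓ+1}}, and this falling factorial splits as
-- (w + ℓ)^{\underline ℓ} · w · (w - 1)^{\underline k}, where (w - 1)^{\underline k} = (-1)^k (k - w)^{\underline k}.
-- Together with (k+1)⋯(k+ℓ) = ℓ! C(k+ℓ, ℓ) this is the claimed formula; z ∈ D is
-- what keeps the factors w + ℓ - t, 0 ≤ t ≤ k + ℓ, away from zero.

open import Defs
open import Level using (Level)
open import Data.Nat using (ℕ; _≤_) renaming (_+_ to _+ℕ_)
open import Data.Nat.Combinatorics using (_C_)

open import Algebra.Bundles using (CommutativeRing)
open import Algebra.Solver.Ring.AlmostCommutativeRing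
  using (_-Raw-AlmostCommutative⟶_; fromCommutativeRing)
open import Data.Nat as ℕ using (zero; suc; _<_; _!)
import Data.Nat.Properties as ℕP
open import Data.Nat.Properties using (_!≢0; _!*_!≢0)
open import Data.Nat.DivMod using (m/n*n≡m)
open import Data.Nat.Combinatorics using (k![n∸k]!∣n!; nCk+nC[k+1]≡[n+1]C[k+1])
open import Data.Nat.Combinatorics.Specification using (nCk≡n!/k![n-k]!; k>n⇒nCk≡0)
open import Data.Nat.Solver using (module +-*-Solver)
open import Data.Integer as ℤ using (ℤ; +_; -[1+_]; _⊖_; sign; ∣_∣; _◃_)
import Data.Integer.Properties as ℤP
open import Data.Sign as Sign using (Sign)
open import Data.Product using (_,_) renaming (_×_ to _∧_)
open import Data.Sum using (inj₁; inj₂)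
open import Data.Maybe using (Maybe; just; nothing)
open import Relation.Nullary using (¬_; yes; no)
open import Relation.Binary.PropositionalEquality as ≡ using (_≡_; module ≡-Reasoning)

module IntegerCoefficients {c ℓ : Level} (R : CommutativeRing c ℓ) where
  open CommutativeRing R
  open import Relation.Binary.Reasoning.Setoid setoid
  open import Algebra.Properties.Ring ring
    using (-‿involutive; -0#≈0#; -1*x≈-x; -‿+-comm)
  open import Algebra.Properties.Semiring.Mult semiring
    using (_×_; ×-homo-+; ×1-homo-*)
  open import Algebra.Properties.CommutativeSemigroup *-commutativeSemigroup
    using (interchange)

  natIn≈×1# : ∀ n → natIn R n ≈ n × 1#
  natIn≈×1# zero    = refl
  natIn≈×1# (suc n) = +-congˡ (natIn≈×1# n)

  natIn-+ : ∀ m n → natIn R (m ℕ.+ n) ≈ natIn R m + natIn R n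
  natIn-+ m n = begin
    natIn R (m ℕ.+ n)         ≈⟨ natIn≈×1# (m ℕ.+ n) ⟩
    (m ℕ.+ n) × 1#            ≈⟨ ×-homo-+ 1# m n ⟩
    m × 1# + n × 1#           ≈⟨ sym (+-cong (natIn≈×1# m) (natIn≈×1# n)) ⟩
    natIn R m + natIn R n     ∎

  natIn-* : ∀ m n → natIn R (m ℕ.* n) ≈ natIn R m * natIn R n
  natIn-* m n = begin
    natIn R (m ℕ.* n)         ≈⟨ natIn≈×1# (m ℕ.* n) ⟩
    (m ℕ.* n) × 1#            ≈⟨ ×1-homo-* m n ⟩
    m × 1# * n × 1#           ≈⟨ sym (*-cong (natIn≈×1# m) (natIn≈×1# n)) ⟩
    natIn R m * natIn R n     ∎

  fromℤ : ℤ → Carrier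
  fromℤ (+ n)    = natIn R n
  fromℤ -[1+ n ] = - natIn R (suc n)

  fromSign : Sign → Carrier
  fromSign Sign.+ = 1#
  fromSign Sign.- = - 1#

  fromℤ-⊖ : ∀ m n → fromℤ (m ⊖ n) ≈ natIn R m - natIn R n
  fromℤ-⊖ m       zero    = sym (trans (+-congˡ -0#≈0#) (+-identityʳ _))
  fromℤ-⊖ zero    (suc n) = sym (+-identityˡ _)
  fromℤ-⊖ (suc m) (suc n) = begin
    fromℤ (suc m ⊖ suc n)               ≡⟨ ≡.cong fromℤ (ℤP.[1+m]⊖[1+n]≡m⊖n m n) ⟩
    fromℤ (m ⊖ n)                       ≈⟨ fromℤ-⊖ m n ⟩
    natIn R m - natIn R n               ≈⟨ cancel (natIn R m) (natIn R n) ⟨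
    natIn R (suc m) - natIn R (suc n)   ∎
    where
    cancel : ∀ a b → (1# + a) - (1# + b) ≈ a - b
    cancel a b = begin
      (1# + a) + - (1# + b)     ≈⟨ +-congˡ (-‿+-comm 1# b) ⟨
      (1# + a) + (- 1# + - b)   ≈⟨ +-congʳ (+-comm 1# a) ⟩
      (a + 1#) + (- 1# + - b)   ≈⟨ +-assoc a 1# _ ⟩
      a + (1# + (- 1# + - b))   ≈⟨ +-congˡ (+-assoc 1# (- 1#) (- b)) ⟨
      a + ((1# + - 1#) + - b)   ≈⟨ +-congˡ (+-congʳ (-‿inverseʳ 1#)) ⟩
      a + (0# + - b)            ≈⟨ +-congˡ (+-identityˡ (- b)) ⟩
      a - b                     ∎

  fromℤ-+ : ∀ i j → fromℤ (i ℤ.+ j) ≈ fromℤ i + fromℤ j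
  fromℤ-+ (+ m)    (+ n)    = natIn-+ m n
  fromℤ-+ (+ m)    -[1+ n ] = fromℤ-⊖ m (suc n)
  fromℤ-+ -[1+ m ] (+ n)    = trans (fromℤ-⊖ n (suc m)) (+-comm _ _)
  fromℤ-+ -[1+ m ] -[1+ n ] = begin
    - natIn R (suc (suc (m ℕ.+ n)))        ≡⟨ ≡.cong (λ x → - natIn R (suc x)) (ℕP.+-suc m n) ⟨
    - natIn R (suc m ℕ.+ suc n)            ≈⟨ -‿cong (natIn-+ (suc m) (suc n)) ⟩
    - (natIn R (suc m) + natIn R (suc n))  ≈⟨ -‿+-comm _ _ ⟨
    - natIn R (suc m) + - natIn R (suc n)   ∎

  fromℤ-neg : ∀ i → fromℤ (ℤ.- i) ≈ - fromℤ i
  fromℤ-neg (+ zero)  = sym -0#≈0#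
  fromℤ-neg (+ suc n) = refl
  fromℤ-neg -[1+ n ]  = sym (-‿involutive _)

  fromℤ-◃ : ∀ s n → fromℤ (s ◃ n) ≈ fromSign s * natIn R n
  fromℤ-◃ s       zero    = sym (zeroʳ _)
  fromℤ-◃ Sign.+ (suc n) = sym (*-identityˡ _)
  fromℤ-◃ Sign.- (suc n) = sym (-1*x≈-x _)

  fromℤ-sign-abs : ∀ i → fromℤ i ≈ fromSign (sign i) * natIn R ∣ i ∣
  fromℤ-sign-abs (+ n)    = sym (*-identityˡ _)
  fromℤ-sign-abs -[1+ n ] = sym (-1*x≈-x _)

  fromSign-* : ∀ s t → fromSign (s Sign.* t) ≈ fromSign s * fromSign t
  fromSign-* Sign.+ t      = sym (*-identityˡ _)
  fromSign-* Sign.- Sign.+ = sym (*-identityʳ _)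
  fromSign-* Sign.- Sign.- = sym (trans (-1*x≈-x _) (-‿involutive _))

  fromℤ-* : ∀ i j → fromℤ (i ℤ.* j) ≈ fromℤ i * fromℤ j
  fromℤ-* i j = begin
    fromℤ ((sign i Sign.* sign j) ◃ (∣ i ∣ ℕ.* ∣ j ∣))
      ≈⟨ fromℤ-◃ (sign i Sign.* sign j) (∣ i ∣ ℕ.* ∣ j ∣) ⟩
    fromSign (sign i Sign.* sign j) * natIn R (∣ i ∣ ℕ.* ∣ j ∣)
      ≈⟨ *-cong (fromSign-* (sign i) (sign j)) (natIn-* ∣ i ∣ ∣ j ∣) ⟩
    (fromSign (sign i) * fromSign (sign j)) * (natIn R ∣ i ∣ * natIn R ∣ j ∣)
      ≈⟨ interchange _ _ _ _ ⟩
    (fromSign (sign i) * natIn R ∣ i ∣) * (fromSign (sign j) * natIn R ∣ j ∣)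
      ≈⟨ *-cong (fromℤ-sign-abs i) (fromℤ-sign-abs j) ⟨
    fromℤ i * fromℤ j ∎

  fromℤ-morphism : ℤ.+-*-rawRing -Raw-AlmostCommutative⟶ fromCommutativeRing R
  fromℤ-morphism = record
    { ⟦_⟧ = fromℤ ; +-homo = fromℤ-+ ; *-homo = fromℤ-* ; -‿homo = fromℤ-neg
    ; 0-homo = refl ; 1-homo = +-identityʳ 1# }

  fromℤ-≟ : ∀ i j → Maybe (fromℤ i ≈ fromℤ j)
  fromℤ-≟ i j with i ℤ.≟ j
  ... | yes ≡.refl = just refl
  ... | no _       = nothing

  open import Algebra.Solver.Ring ℤ.+-*-rawRing (fromCommutativeRing R) fromℤ-morphism fromℤ-≟
    public

risingFactorial : ℕ → ℕ → ℕ
risingFactorial m zero    = 1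
risingFactorial m (suc l) = risingFactorial m l ℕ.* (l ℕ.+ m)

binomial-*-factorials : ∀ {n m} → m ≤ n → (n C m) ℕ.* (m ! ℕ.* (n ℕ.∸ m) !) ≡ n !
binomial-*-factorials {n} {m} m≤n = begin
  (n C m) ℕ.* (m ! ℕ.* (n ℕ.∸ m) !)
    ≡⟨ ≡.cong (ℕ._* (m ! ℕ.* (n ℕ.∸ m) !)) (nCk≡n!/k![n-k]! m≤n) ⟩
  n ! ℕ./ (m ! ℕ.* (n ℕ.∸ m) !) ℕ.* (m ! ℕ.* (n ℕ.∸ m) !)
    ≡⟨ m/n*n≡m (k![n∸k]!∣n! m≤n) ⟩
  n ! ∎
  where
  open ≡-Reasoning
  instance _ = m !* (n ℕ.∸ m) !≢0

factorial-risingFactorial : ∀ k l → (l ℕ.+ k) ! ≡ risingFactorial (suc k) l ℕ.* k !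
factorial-risingFactorial k zero    = ≡.sym (ℕP.*-identityˡ (k !))
factorial-risingFactorial k (suc l) = begin
  suc (l ℕ.+ k) ℕ.* (l ℕ.+ k) !
    ≡⟨ ≡.cong (suc (l ℕ.+ k) ℕ.*_) (factorial-risingFactorial k l) ⟩
  suc (l ℕ.+ k) ℕ.* (risingFactorial (suc k) l ℕ.* k !)
    ≡⟨ ≡.cong (λ n → n ℕ.* (risingFactorial (suc k) l ℕ.* k !)) (ℕP.+-suc l k) ⟨
  (l ℕ.+ suc k) ℕ.* (risingFactorial (suc k) l ℕ.* k !)
    ≡⟨ ℕ-solve 3 (λ n A f → n :* (A :* f) := A :* n :* f)
               ≡.refl (l ℕ.+ suc k) (risingFactorial (suc k) l) (k !) ⟩
  risingFactorial (suc k) (suc l) ℕ.* k !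
    ∎
  where open ≡-Reasoning
        open +-*-Solver renaming (solve to ℕ-solve)

risingFactorial-binomial : ∀ k l → risingFactorial (suc k) l ≡ l ! ℕ.* ((k ℕ.+ l) C l)
risingFactorial-binomial k l = ≡.sym (ℕP.*-cancelʳ-≡ _ _ (k !) {{k !≢0}} (begin
  l ! ℕ.* ((k ℕ.+ l) C l) ℕ.* k !
    ≡⟨ ℕ-solve 3 (λ a b c → a :* b :* c := b :* (a :* c)) ≡.refl (l !) ((k ℕ.+ l) C l) (k !) ⟩
  ((k ℕ.+ l) C l) ℕ.* (l ! ℕ.* k !)
    ≡⟨ ≡.cong (λ n → ((k ℕ.+ l) C l) ℕ.* (l ! ℕ.* n !)) (ℕP.m+n∸n≡m k l) ⟨
  ((k ℕ.+ l) C l) ℕ.* (l ! ℕ.* (k ℕ.+ l ℕ.∸ l) !)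
    ≡⟨ binomial-*-factorials (ℕP.m≤n+m l k) ⟩
  (k ℕ.+ l) !
    ≡⟨ ≡.cong _! (ℕP.+-comm k l) ⟩
  (l ℕ.+ k) !
    ≡⟨ factorial-risingFactorial k l ⟩
  risingFactorial (suc k) l ℕ.* k !
    ∎))
  where open ≡-Reasoning
        open +-*-Solver renaming (solve to ℕ-solve)

⊖-bounded : ∀ {k l t} → l ≤ k → t ≤ l ℕ.+ k → (ℤ.- + k ℤ.≤ t ⊖ l) ∧ (t ⊖ l ℤ.≤ + k)
⊖-bounded {k} {l} {t} l≤k t≤l+k with ℕP.≤-total l t
... | inj₁ l≤t rewrite ℤP.⊖-≥ l≤t =
  ℤP.neg-≤-pos , ℤ.+≤+ (ℕP.m≤n+o⇒m∸n≤o t l t≤l+k)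
... | inj₂ t≤l rewrite ℤP.⊖-≤ t≤l =
  ℤP.neg-mono-≤ (ℤ.+≤+ (ℕP.≤-trans (ℕP.m∸n≤m l t) l≤k)) , ℤP.neg-≤-pos

module CharZeroFieldLemmas {a b : Level} (F : CharZeroField a b) where
  open CharZeroField F
  open FieldNotation F
  open IntegerCoefficients commutativeRing
    using (solve; _:=_; _:+_; _:-_; _:*_; :-_; con; natIn-+; natIn-*; fromℤ; fromℤ-⊖)
  open import Algebra.Properties.Ring ring using (-‿distribˡ-*; -0#≈0#)
  open import Algebra.Properties.CommutativeSemigroup *-commutativeSemigroup
    using (interchange; x∙yz≈yx∙z)
  open import Relation.Binary.Reasoning.Setoid setoid

  1#≉0# : ¬ 1# ≈ 0#
  1#≉0# h = charZero 0 (trans (+-identityʳ 1#) h)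

  x*y≉0⇒x≉0 : ∀ {x y} → ¬ x * y ≈ 0# → ¬ x ≈ 0#
  x*y≉0⇒x≉0 {x} {y} h x≈0 = h (trans (*-congʳ x≈0) (zeroˡ y))

  x*y≉0⇒y≉0 : ∀ {x y} → ¬ x * y ≈ 0# → ¬ y ≈ 0#
  x*y≉0⇒y≉0 {x} {y} h y≈0 = h (trans (*-congˡ y≈0) (zeroʳ x))

  *-≉0 : ∀ {x y} → ¬ x ≈ 0# → ¬ y ≈ 0# → ¬ x * y ≈ 0#
  *-≉0 {x} {y} x≉0 y≉0 x*y≈0 = x≉0 (begin
    x                 ≈⟨ *-identityʳ x ⟨
    x * 1#            ≈⟨ *-congˡ (inverseʳ y y≉0) ⟨
    x * (y * y ⁻¹)    ≈⟨ *-assoc x y (y ⁻¹) ⟨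
    (x * y) * y ⁻¹    ≈⟨ *-congʳ x*y≈0 ⟩
    0# * y ⁻¹         ≈⟨ zeroˡ _ ⟩
    0#                ∎)

  x*y≈1⇒x⁻¹≈y : ∀ {x y} → x * y ≈ 1# → x ⁻¹ ≈ y
  x*y≈1⇒x⁻¹≈y {x} {y} x*y≈1 = begin
    x ⁻¹                ≈⟨ *-identityʳ _ ⟨
    x ⁻¹ * 1#           ≈⟨ *-congˡ x*y≈1 ⟨
    x ⁻¹ * (x * y)      ≈⟨ x∙yz≈yx∙z (x ⁻¹) x y ⟩
    (x * x ⁻¹) * y      ≈⟨ *-congʳ (inverseʳ x x≉0) ⟩
    1# * y              ≈⟨ *-identityˡ y ⟩
    y                   ∎
    where
    x≉0 : ¬ x ≈ 0#
    x≉0 x≈0 = 1#≉0# (trans (sym x*y≈1) (trans (*-congʳ x≈0) (zeroˡ y)))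

  x*y≈z⇒x⁻¹≈y/z : ∀ {x y z} → ¬ z ≈ 0# → x * y ≈ z → x ⁻¹ ≈ y / z
  x*y≈z⇒x⁻¹≈y/z {x} {y} {z} z≉0 x*y≈z = x*y≈1⇒x⁻¹≈y (begin
    x * (y * z ⁻¹)    ≈⟨ *-assoc x y (z ⁻¹) ⟨
    (x * y) * z ⁻¹    ≈⟨ *-congʳ x*y≈z ⟩
    z * z ⁻¹          ≈⟨ inverseʳ z z≉0 ⟩
    1#                ∎)

  ⁻¹-distrib-* : ∀ {x y} → ¬ x * y ≈ 0# → (x * y) ⁻¹ ≈ x ⁻¹ * y ⁻¹
  ⁻¹-distrib-* {x} {y} x*y≉0 = x*y≈1⇒x⁻¹≈y (begin
    (x * y) * (x ⁻¹ * y ⁻¹)    ≈⟨ interchange x y (x ⁻¹) (y ⁻¹) ⟩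
    (x * x ⁻¹) * (y * y ⁻¹)    ≈⟨ *-cong (inverseʳ x (x*y≉0⇒x≉0 x*y≉0)) (inverseʳ y (x*y≉0⇒y≉0 x*y≉0)) ⟩
    1# * 1#                    ≈⟨ *-identityˡ 1# ⟩
    1#                         ∎)

  sgn-+ : ∀ m n → sgn (m ℕ.+ n) ≈ sgn m * sgn n
  sgn-+ zero    n = sym (*-identityˡ _)
  sgn-+ (suc m) n = trans (-‿cong (sgn-+ m n)) (-‿distribˡ-* (sgn m) (sgn n))

  sgn⁻¹ : ∀ n → sgn n ⁻¹ ≈ sgn n
  sgn⁻¹ n = x*y≈1⇒x⁻¹≈y (sgn*sgn n)
    where
    sgn*sgn : ∀ n → sgn n * sgn n ≈ 1#
    sgn*sgn zero    = *-identityˡ 1#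
    sgn*sgn (suc n) = trans (solve 1 (λ s → (:- s) :* (:- s) := s :* s) refl (sgn n)) (sgn*sgn n)

  sgn-∸-suc : ∀ {l j} → j < l → sgn (l ℕ.∸ j) ≈ - sgn (l ℕ.∸ suc j)
  sgn-∸-suc j<l = reflexive (≡.cong sgn (ℕP.+-∸-assoc 1 j<l))

  fallingFact-cong : ∀ n {x y} → x ≈ y → fallingFact x n ≈ fallingFact y n
  fallingFact-cong zero    x≈y = refl
  fallingFact-cong (suc n) x≈y = *-cong (fallingFact-cong n x≈y) (+-congʳ x≈y)

  fallingFact-suc : ∀ n x → fallingFact x (suc n) ≈ x * fallingFact (x - 1#) n
  fallingFact-suc zero    x = solve 2 (λ x o → o :* (x :- con (ℤ.+ 0)) := x :* o) refl x 1#
  fallingFact-suc (suc n) x = begin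
    fallingFact x (suc n) * (x - ι (suc n))
      ≈⟨ *-congʳ (fallingFact-suc n x) ⟩
    (x * fallingFact (x - 1#) n) * (x - (1# + ι n))
      ≈⟨ solve 4 (λ x G o n → (x :* G) :* (x :- (o :+ n)) := x :* (G :* ((x :- o) :- n)))
               refl x (fallingFact (x - 1#) n) 1# (ι n) ⟩
    x * (fallingFact (x - 1#) n * ((x - 1#) - ι n))
      ∎

  fallingFact-+ : ∀ m n x → fallingFact x (m ℕ.+ n) ≈ fallingFact x m * fallingFact (x - ι m) n
  fallingFact-+ zero    n x = begin
    fallingFact x n               ≈⟨ fallingFact-cong n (solve 1 (λ x → x := x :- con (ℤ.+ 0)) refl x) ⟩
    fallingFact (x - ι 0) n       ≈⟨ *-identityˡ _ ⟨
    1# * fallingFact (x - ι 0) n  ∎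
  fallingFact-+ (suc m) n x = begin
    fallingFact x (suc (m ℕ.+ n))
      ≈⟨ fallingFact-suc (m ℕ.+ n) x ⟩
    x * fallingFact (x - 1#) (m ℕ.+ n)
      ≈⟨ *-congˡ (fallingFact-+ m n (x - 1#)) ⟩
    x * (fallingFact (x - 1#) m * fallingFact ((x - 1#) - ι m) n)
      ≈⟨ *-congˡ (*-congˡ (fallingFact-cong n
           (solve 3 (λ x o m → (x :- o) :- m := x :- (o :+ m)) refl x 1# (ι m)))) ⟩
    x * (fallingFact (x - 1#) m * fallingFact (x - ι (suc m)) n)
      ≈⟨ *-assoc x _ _ ⟨
    (x * fallingFact (x - 1#) m) * fallingFact (x - ι (suc m)) n
      ≈⟨ *-congʳ (fallingFact-suc m x) ⟨
    fallingFact x (suc m) * fallingFact (x - ι (suc m)) n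
      ∎

  fallingFact-reflect : ∀ n x → sgn n * fallingFact (ι n - x) n ≈ fallingFact (x - 1#) n
  fallingFact-reflect zero    x = *-identityˡ 1#
  fallingFact-reflect (suc n) x = begin
    - sgn n * fallingFact (ι (suc n) - x) (suc n)
      ≈⟨ *-congˡ (fallingFact-suc n _) ⟩
    - sgn n * ((ι (suc n) - x) * fallingFact ((ι (suc n) - x) - 1#) n)
      ≈⟨ *-congˡ (*-congˡ (fallingFact-cong n
           (solve 3 (λ o n x → ((o :+ n) :- x) :- o := n :- x) refl 1# (ι n) x))) ⟩
    - sgn n * ((1# + ι n - x) * fallingFact (ι n - x) n)
      ≈⟨ solve 5 (λ s o n x G → (:- s) :* (((o :+ n) :- x) :* G) := (s :* G) :* ((x :- o) :- n))
               refl (sgn n) 1# (ι n) x (fallingFact (ι n - x) n) ⟩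
    (sgn n * fallingFact (ι n - x) n) * ((x - 1#) - ι n)
      ≈⟨ *-congʳ (fallingFact-reflect n x) ⟩
    fallingFact (x - 1#) n * ((x - 1#) - ι n)
      ∎

  prodBelow-fallingFact : ∀ n {f : ℕ → Carrier} x → (∀ t → f t ≈ x - ι t) →
    prodBelow n f ≈ fallingFact x n
  prodBelow-fallingFact zero    x f≈ = refl
  prodBelow-fallingFact (suc n) x f≈ = *-cong (prodBelow-fallingFact n x f≈) (f≈ n)

  FallingFactorsNonzero : Carrier → ℕ → Set b
  FallingFactorsNonzero x n = ∀ t → t < n → ¬ x - ι t ≈ 0#

  FallingFactorsNonzero-cong : ∀ {x y} n → x ≈ y → FallingFactorsNonzero x n → FallingFactorsNonzero y n
  FallingFactorsNonzero-cong n x≈y nz t t<n y-t≈0 = nz t t<n (trans (+-congʳ x≈y) y-t≈0)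

  FallingFactorsNonzero-init : ∀ {x} n → FallingFactorsNonzero x (suc n) → FallingFactorsNonzero x n
  FallingFactorsNonzero-init n nz t t<n = nz t (ℕP.m<n⇒m<1+n t<n)

  FallingFactorsNonzero-tail : ∀ {x} n → FallingFactorsNonzero (x + 1#) (suc n) → FallingFactorsNonzero x n
  FallingFactorsNonzero-tail {x} n nz t t<n x-t≈0 = nz (suc t) (ℕ.s≤s t<n)
    (trans (solve 3 (λ x o t → (x :+ o) :- (o :+ t) := x :- t) refl x 1# (ι t)) x-t≈0)

  fallingFact-≉0 : ∀ n {x} → FallingFactorsNonzero x n → ¬ fallingFact x n ≈ 0#
  fallingFact-≉0 zero    nz = 1#≉0#
  fallingFact-≉0 (suc n) nz =
    *-≉0 (fallingFact-≉0 n (FallingFactorsNonzero-init n nz)) (nz n ℕP.≤-refl)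

  fallingFact⁻¹-difference : ∀ n x → ¬ fallingFact (x + 1#) (suc n) ≈ 0# →
    fallingFact (x + 1#) n ⁻¹ - fallingFact x n ⁻¹ ≈ - ι n * fallingFact (x + 1#) (suc n) ⁻¹
  fallingFact⁻¹-difference n x p≉0 = begin
    fallingFact (x + 1#) n ⁻¹ - fallingFact x n ⁻¹
      ≈⟨ +-cong (x*y≈z⇒x⁻¹≈y/z p≉0 refl) (-‿cong (x*y≈z⇒x⁻¹≈y/z p≉0 prepend)) ⟩
    (x + 1# - ι n) / p - (x + 1#) / p
      ≈⟨ solve 4 (λ x o n p′ → (x :+ o :- n) :* p′ :- (x :+ o) :* p′ := (:- n) :* p′)
               refl x 1# (ι n) (p ⁻¹) ⟩
    - ι n / p
      ∎
    where
    p : Carrier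
    p = fallingFact (x + 1#) (suc n)
    prepend : fallingFact x n * (x + 1#) ≈ p
    prepend = begin
      fallingFact x n * (x + 1#)                ≈⟨ *-comm _ _ ⟩
      (x + 1#) * fallingFact x n
        ≈⟨ *-congˡ (fallingFact-cong n (solve 2 (λ x o → x := (x :+ o) :- o) refl x 1#)) ⟩
      (x + 1#) * fallingFact (x + 1# - 1#) n    ≈⟨ fallingFact-suc n (x + 1#) ⟨
      p                                         ∎

  sumBelow-cong : ∀ n {f g : ℕ → Carrier} → (∀ j → j < n → f j ≈ g j) →
    sumBelow n f ≈ sumBelow n g
  sumBelow-cong zero    f≈g = refl
  sumBelow-cong (suc n) f≈g =
    +-cong (sumBelow-cong n (λ j j<n → f≈g j (ℕP.m<n⇒m<1+n j<n))) (f≈g n ℕP.≤-refl)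

  sumBelow-suc : ∀ n (f : ℕ → Carrier) → sumBelow (suc n) f ≈ f 0 + sumBelow n (λ j → f (suc j))
  sumBelow-suc zero    f = +-comm 0# (f 0)
  sumBelow-suc (suc n) f = trans (+-congʳ (sumBelow-suc n f)) (+-assoc _ _ _)

  sumBelow-- : ∀ n (f g : ℕ → Carrier) → sumBelow n (λ j → f j - g j) ≈ sumBelow n f - sumBelow n g
  sumBelow-- zero    f g = sym (trans (+-congˡ -0#≈0#) (+-identityʳ 0#))
  sumBelow-- (suc n) f g = trans (+-congʳ (sumBelow-- n f g))
    (solve 4 (λ F G f g → (F :- G) :+ (f :- g) := (F :+ f) :- (G :+ g)) refl _ _ (f n) (g n))

  signedBinomial : ℕ → ℕ → Carrier
  signedBinomial l j = sgn (l ℕ.∸ j) * ι (l C j)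

  signedBinomial-vanishes : ∀ {l j} → l < j → signedBinomial l j ≈ 0#
  signedBinomial-vanishes l<j = trans (*-congˡ (reflexive (≡.cong ι (k>n⇒nCk≡0 l<j)))) (zeroʳ _)

  signedBinomial-pascal : ∀ l j →
    signedBinomial (suc l) (suc j) ≈ signedBinomial l j - signedBinomial l (suc j)
  signedBinomial-pascal l j = begin
    sgn (l ℕ.∸ j) * ι (suc l C suc j)
      ≡⟨ ≡.cong (λ n → sgn (l ℕ.∸ j) * ι n) (nCk+nC[k+1]≡[n+1]C[k+1] l j) ⟨
    sgn (l ℕ.∸ j) * ι (l C j ℕ.+ l C suc j)
      ≈⟨ *-congˡ (natIn-+ (l C j) (l C suc j)) ⟩
    sgn (l ℕ.∸ j) * (ι (l C j) + ι (l C suc j))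
      ≈⟨ distribˡ _ _ _ ⟩
    signedBinomial l j + sgn (l ℕ.∸ j) * ι (l C suc j)
      ≈⟨ +-congˡ alternate ⟩
    signedBinomial l j - signedBinomial l (suc j)
      ∎
    where
    alternate : sgn (l ℕ.∸ j) * ι (l C suc j) ≈ - signedBinomial l (suc j)
    alternate with j ℕ.<? l
    ... | yes j<l = trans (*-congʳ (sgn-∸-suc j<l)) (sym (-‿distribˡ-* _ _))
    ... | no  j≮l = begin
      sgn (l ℕ.∸ j) * ι (l C suc j)   ≈⟨ *-congˡ (reflexive (≡.cong ι (k>n⇒nCk≡0 l<1+j))) ⟩
      sgn (l ℕ.∸ j) * 0#              ≈⟨ zeroʳ _ ⟩
      0#                              ≈⟨ -0#≈0# ⟨
      - 0#                            ≈⟨ -‿cong (signedBinomial-vanishes l<1+j) ⟨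
      - signedBinomial l (suc j)      ∎
      where
      l<1+j : l < suc j
      l<1+j = ℕ.s≤s (ℕP.≮⇒≥ j≮l)

  Δ : ℕ → (ℕ → Carrier) → Carrier
  Δ l g = sumBelow (suc l) (λ j → signedBinomial l j * g j)

  Δ-cong : ∀ l {g h : ℕ → Carrier} → (∀ j → g j ≈ h j) → Δ l g ≈ Δ l h
  Δ-cong l g≈h = sumBelow-cong (suc l) (λ j _ → *-congˡ (g≈h j))

  Δ-suc : ∀ l g → Δ (suc l) g ≈ Δ l (λ j → g (suc j)) - Δ l g
  Δ-suc l g = begin
    Δ (suc l) g
      ≈⟨ sumBelow-suc (suc l) _ ⟩
    signedBinomial (suc l) 0 * g 0 + sumBelow (suc l) (λ j → signedBinomial (suc l) (suc j) * g (suc j))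
      ≈⟨ +-congˡ (sumBelow-cong (suc l) (λ j _ → pascal j)) ⟩
    - sgn l * ι 1 * g 0 + sumBelow (suc l) (λ j → bin j * g (suc j) - bin (suc j) * g (suc j))
      ≈⟨ +-congˡ (sumBelow-- (suc l) _ _) ⟩
    - sgn l * ι 1 * g 0 + (Δ l (λ j → g (suc j)) - tail)
      ≈⟨ solve 5 (λ s o g D T → (:- s) :* o :* g :+ (D :- T) := D :- (s :* o :* g :+ T))
               refl (sgn l) (ι 1) (g 0) (Δ l (λ j → g (suc j))) tail ⟩
    Δ l (λ j → g (suc j)) - (bin 0 * g 0 + tail)
      ≈⟨ +-congˡ (-‿cong (sumBelow-suc (suc l) _)) ⟨
    Δ l (λ j → g (suc j)) - sumBelow (suc (suc l)) (λ j → bin j * g j)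
      ≈⟨ +-congˡ (-‿cong (+-congˡ (trans (*-congʳ (signedBinomial-vanishes {l} ℕP.≤-refl)) (zeroˡ _)))) ⟩
    Δ l (λ j → g (suc j)) - (Δ l g + 0#)
      ≈⟨ +-congˡ (-‿cong (+-identityʳ _)) ⟩
    Δ l (λ j → g (suc j)) - Δ l g
      ∎
    where
    bin : ℕ → Carrier
    bin = signedBinomial l
    tail : Carrier
    tail = sumBelow (suc l) (λ j → bin (suc j) * g (suc j))
    pascal : ∀ j → signedBinomial (suc l) (suc j) * g (suc j) ≈ bin j * g (suc j) - bin (suc j) * g (suc j)
    pascal j = trans (*-congʳ (signedBinomial-pascal l j))
      (solve 3 (λ a b g → (a :- b) :* g := a :* g :- b :* g) refl (bin j) (bin (suc j)) (g (suc j)))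

  Δ-reciprocal-fallingFact : ∀ m l x → FallingFactorsNonzero (x + ι l) (l ℕ.+ m) →
    Δ l (λ j → fallingFact (x + ι j) m ⁻¹)
      ≈ sgn l * ι (risingFactorial m l) * fallingFact (x + ι l) (l ℕ.+ m) ⁻¹
  Δ-reciprocal-fallingFact m zero    x nz = +-identityˡ _
  Δ-reciprocal-fallingFact m (suc l) x nz = begin
    Δ (suc l) (g x)
      ≈⟨ Δ-suc l (g x) ⟩
    Δ l (λ j → g x (suc j)) - Δ l (g x)
      ≈⟨ +-congʳ (Δ-cong l (λ j → ⁻¹-cong (fallingFact-cong m (shift j)))) ⟩
    Δ l (g (x + 1#)) - Δ l (g x)
      ≈⟨ +-cong (Δ-reciprocal-fallingFact m l (x + 1#) nz₊) (-‿cong (Δ-reciprocal-fallingFact m l x nz₀)) ⟩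
    s * A * fallingFact (x + 1# + ι l) n ⁻¹ - s * A * fallingFact y n ⁻¹
      ≈⟨ +-congʳ (*-congˡ (⁻¹-cong (fallingFact-cong n (sym y+1≈))) ) ⟩
    s * A * fallingFact (y + 1#) n ⁻¹ - s * A * fallingFact y n ⁻¹
      ≈⟨ solve 4 (λ s A u v → s :* A :* u :- s :* A :* v := s :* A :* (u :- v)) refl s A _ _ ⟩
    s * A * (fallingFact (y + 1#) n ⁻¹ - fallingFact y n ⁻¹)
      ≈⟨ *-congˡ (fallingFact⁻¹-difference n y (fallingFact-≉0 (suc n) nz′)) ⟩
    s * A * (- ι n * fallingFact (y + 1#) (suc n) ⁻¹)
      ≈⟨ solve 4 (λ s A N P → s :* A :* ((:- N) :* P) := (:- s) :* (A :* N) :* P) refl s A (ι n) _ ⟩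
    - s * (A * ι n) * fallingFact (y + 1#) (suc n) ⁻¹
      ≈⟨ *-cong (*-congˡ (sym (natIn-* (risingFactorial m l) n)))
                (⁻¹-cong (fallingFact-cong (suc n) (sym x+1+l≈))) ⟩
    - s * ι (risingFactorial m l ℕ.* n) * fallingFact (x + ι (suc l)) (suc n) ⁻¹
      ∎
    where
    g : Carrier → ℕ → Carrier
    g x j = fallingFact (x + ι j) m ⁻¹
    n : ℕ
    n = l ℕ.+ m
    y s A : Carrier
    y = x + ι l
    s = sgn l
    A = ι (risingFactorial m l)
    shift : ∀ j → x + ι (suc j) ≈ (x + 1#) + ι j
    shift j = solve 3 (λ x o j → x :+ (o :+ j) := (x :+ o) :+ j) refl x 1# (ι j)
    x+1+l≈ : x + ι (suc l) ≈ y + 1#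
    x+1+l≈ = solve 3 (λ x o l → x :+ (o :+ l) := (x :+ l) :+ o) refl x 1# (ι l)
    y+1≈ : y + 1# ≈ x + 1# + ι l
    y+1≈ = solve 3 (λ x o l → (x :+ l) :+ o := (x :+ o) :+ l) refl x 1# (ι l)
    nz′ : FallingFactorsNonzero (y + 1#) (suc n)
    nz′ = FallingFactorsNonzero-cong (suc n) x+1+l≈ nz
    nz₊ : FallingFactorsNonzero (x + 1# + ι l) n
    nz₊ = FallingFactorsNonzero-cong n y+1≈ (FallingFactorsNonzero-init n nz′)
    nz₀ : FallingFactorsNonzero y n
    nz₀ = FallingFactorsNonzero-tail n nz′

  fallingFact-split-reflect : ∀ k l w →
    fallingFact (w + ι l) (l ℕ.+ suc k)
      ≈ sgn k * (w * (fallingFact (ι k - w) k * fallingFact (w + ι l) l))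
  fallingFact-split-reflect k l w = begin
    fallingFact (w + ι l) (l ℕ.+ suc k)
      ≈⟨ fallingFact-+ l (suc k) (w + ι l) ⟩
    fallingFact (w + ι l) l * fallingFact (w + ι l - ι l) (suc k)
      ≈⟨ *-congˡ (fallingFact-cong (suc k) (solve 2 (λ w l → w :+ l :- l := w) refl w (ι l))) ⟩
    fallingFact (w + ι l) l * fallingFact w (suc k)
      ≈⟨ *-congˡ (fallingFact-suc k w) ⟩
    fallingFact (w + ι l) l * (w * fallingFact (w - 1#) k)
      ≈⟨ *-congˡ (*-congˡ (fallingFact-reflect k w)) ⟨
    fallingFact (w + ι l) l * (w * (sgn k * fallingFact (ι k - w) k))
      ≈⟨ solve 4 (λ L w s K → L :* (w :* (s :* K)) := s :* (w :* (K :* L)))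
               refl (fallingFact (w + ι l) l) w (sgn k) (fallingFact (ι k - w) k) ⟩
    sgn k * (w * (fallingFact (ι k - w) k * fallingFact (w + ι l) l))
      ∎

  ι-≉0 : ∀ n → 1 ≤ n → ¬ ι n ≈ 0#
  ι-≉0 (suc n) _ = charZero n

  ιℤ≡fromℤ : ∀ i → ιℤ i ≡ fromℤ i
  ιℤ≡fromℤ (+ n)    = ≡.refl
  ιℤ≡fromℤ -[1+ n ] = ≡.refl

  P-fallingFact : ∀ r k x → P r k x ≈ fallingFact (x + r) (suc k)
  P-fallingFact r k x = prodBelow-fallingFact (suc k) (x + r)
    (λ t → solve 3 (λ x t r → x :- t :+ r := (x :+ r) :- t) refl x (ι t) r)

  InD⇒FallingFactorsNonzero : ∀ {r k l z} → l ≤ k → InD r k z →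
    FallingFactorsNonzero (z + (r + r) + ι l) (l ℕ.+ suc k)
  InD⇒FallingFactorsNonzero {r} {k} {l} {z} l≤k z∈D t t<l+1+k factor≈0 =
    z∈D (t ⊖ l) (⊖-bounded l≤k t≤l+k) (begin
      z
        ≈⟨ solve 4 (λ z R l t → z := ((t :- l) :- R) :+ (((z :+ R) :+ l) :- t)) refl z (r + r) (ι l) (ι t) ⟩
      (ι t - ι l - (r + r)) + (z + (r + r) + ι l - ι t)  ≈⟨ +-congˡ factor≈0 ⟩
      (ι t - ι l - (r + r)) + 0#                         ≈⟨ +-identityʳ _ ⟩
      ι t - ι l - (r + r)                                ≈⟨ +-congʳ (fromℤ-⊖ t l) ⟨
      fromℤ (t ⊖ l) - (r + r)                            ≡⟨ ≡.cong (_- (r + r)) (ιℤ≡fromℤ (t ⊖ l)) ⟨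
      ιℤ (t ⊖ l) - (r + r)                               ∎)
    where
    t≤l+k : t ≤ l ℕ.+ k
    t≤l+k = ℕP.≤-pred (ℕP.≤-trans t<l+1+k (ℕP.≤-reflexive (ℕP.+-suc l k)))

  R-closedForm : ∀ r k l → l ≤ k → ∀ z → InD r k z →
    R r k l z ≈ sgn (k ℕ.+ l) / (z + (r + r)) * ι ((k ℕ.+ l) C l)
                  / (fallingFact (ι k - (r + r) - z) k * fallingFact (ι l + (r + r) + z) l)
  R-closedForm r k l l≤k z z∈D = begin
    ι (l !) ⁻¹ * Δ l (λ j → P r k (z + ι j + r) ⁻¹)
      ≈⟨ *-congˡ (Δ-cong l (λ j → ⁻¹-cong (P≈ j))) ⟩
    ι (l !) ⁻¹ * Δ l (λ j → fallingFact (w + ι j) (suc k) ⁻¹)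
      ≈⟨ *-congˡ (Δ-reciprocal-fallingFact (suc k) l w (InD⇒FallingFactorsNonzero l≤k z∈D)) ⟩
    ι (l !) ⁻¹ * (sgn l * ι (risingFactorial (suc k) l) * Q ⁻¹)
      ≈⟨ *-congˡ (*-cong (*-congˡ rising≈) Q⁻¹≈) ⟩
    ι (l !) ⁻¹ * (sgn l * (ι (l !) * B) * (sgn k * (w ⁻¹ * (Fk * Fl) ⁻¹)))
      ≈⟨ solve 7 (λ L′ s L B t w′ X′ → L′ :* (s :* (L :* B) :* (t :* (w′ :* X′)))
                                      := (L′ :* L) :* (t :* s :* w′ :* B :* X′))
               refl (ι (l !) ⁻¹) (sgn l) (ι (l !)) B (sgn k) (w ⁻¹) ((Fk * Fl) ⁻¹) ⟩
    (ι (l !) ⁻¹ * ι (l !)) * (sgn k * sgn l / w * B / (Fk * Fl))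
      ≈⟨ *-congʳ (trans (*-comm _ _) (inverseʳ _ (ι-≉0 (l !) (ℕP.1≤n! l)))) ⟩
    1# * (sgn k * sgn l / w * B / (Fk * Fl))
      ≈⟨ *-identityˡ _ ⟩
    sgn k * sgn l / w * B / (Fk * Fl)
      ≈⟨ *-congʳ (*-congʳ (*-congʳ (sgn-+ k l))) ⟨
    sgn (k ℕ.+ l) / w * B / (Fk * Fl)
      ∎
    where
    w B Fk Fl Q : Carrier
    w  = z + (r + r)
    B  = ι ((k ℕ.+ l) C l)
    Fk = fallingFact (ι k - (r + r) - z) k
    Fl = fallingFact (ι l + (r + r) + z) l
    Q  = fallingFact (w + ι l) (l ℕ.+ suc k)

    P≈ : ∀ j → P r k (z + ι j + r) ≈ fallingFact (w + ι j) (suc k)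
    P≈ j = trans (P-fallingFact r k _) (fallingFact-cong (suc k)
      (solve 3 (λ z j r → z :+ j :+ r :+ r := (z :+ (r :+ r)) :+ j) refl z (ι j) r))

    rising≈ : ι (risingFactorial (suc k) l) ≈ ι (l !) * B
    rising≈ = trans (reflexive (≡.cong ι (risingFactorial-binomial k l))) (natIn-* (l !) _)

    Q≈ : Q ≈ sgn k * (w * (Fk * Fl))
    Q≈ = trans (fallingFact-split-reflect k l w)
      (*-congˡ (*-congˡ (*-cong
        (fallingFact-cong k (solve 3 (λ z R k → k :- (z :+ R) := k :- R :- z) refl z (r + r) (ι k)))
        (fallingFact-cong l (solve 3 (λ z R l → (z :+ R) :+ l := l :+ R :+ z) refl z (r + r) (ι l))))))

    Q⁻¹≈ : Q ⁻¹ ≈ sgn k * (w ⁻¹ * (Fk * Fl) ⁻¹)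
    Q⁻¹≈ = begin
      Q ⁻¹                             ≈⟨ ⁻¹-cong Q≈ ⟩
      (sgn k * (w * (Fk * Fl))) ⁻¹     ≈⟨ ⁻¹-distrib-* Q≉0 ⟩
      sgn k ⁻¹ * (w * (Fk * Fl)) ⁻¹    ≈⟨ *-cong (sgn⁻¹ k) (⁻¹-distrib-* (x*y≉0⇒y≉0 Q≉0)) ⟩
      sgn k * (w ⁻¹ * (Fk * Fl) ⁻¹)    ∎
      where
      Q≉0 : ¬ sgn k * (w * (Fk * Fl)) ≈ 0#
      Q≉0 Q≈0 = fallingFact-≉0 (l ℕ.+ suc k) (InD⇒FallingFactorsNonzero l≤k z∈D) (trans Q≈ Q≈0)

-- The identity holds for every r.
proposition2 :
  {a b : Level} (F : CharZeroField a b) →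
  let open CharZeroField F
      open FieldNotation F
  in (c : ℕ) → 1 ≤ c →
     (r : Carrier) → r * r ≈ - ι c →
     (k l : ℕ) → l ≤ k →
     (z : Carrier) → InD r k z →
     R r k l z ≈
       sgn (k +ℕ l) / (z + (r + r)) * ι ((k +ℕ l) C l)
         / (fallingFact (ι k - (r + r) - z) k * fallingFact (ι l + (r + r) + z) l)
proposition2 F _ _ r _ k l l≤k z z∈D = CharZeroFieldLemmas.R-closedForm F r k l l≤k z z∈D
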